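{- Let $G=(V,E)$ be a directed simple $st$-graph and let $(S,T)$ be a connected cut of $G$. Then for every cut $(S',T')$ of $G$, the cut-set of $(S',T')$ is not a proper subset of the cut-set of $(S,T)$.
   Context: A directed simple $st$-graph is a finite directed graph without self-loops or parallel edges, with distinguished source $s$ and sink $t\ne s$, every vertex lying on some directed walk from $s$ to $t$. A cut is a partition $(S,T)$ of $V$ with $s\in S$ and $t\in T$; its cut-set is the set of edges $(u,v)\in E$ with $u\in S$, $v\in T$. The cut is connected if every vertex of $S$ is reachable from $s$ by a directed walk using only vertices of $S$, and every vertex of $T$ reaches $t$ by a directed walk using only vertices of $T$. -}

module Defs where

open import Data.Nat using (ℕ)
open import Data.Fin using (Fin)
open import Data.Bool using (Bool; true; false)
open import Data.Product using (_×_; ∃₂; _,_)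
open import Relation.Binary.PropositionalEquality using (_≡_; _≢_)
open import Relation.Nullary using (¬_)

-- A finite directed graph on vertex set Fin n, given by a Boolean adjacency
-- matrix (so there are no parallel edges); (u , v) ∈ E iff adj u v ≡ true.
record DiGraph (n : ℕ) : Set where
  field
    adj : Fin n → Fin n → Bool

open DiGraph public

Edge : ∀ {n} → DiGraph n → Fin n → Fin n → Set
Edge G u v = adj G u v ≡ true

data WalkIn {n} (G : DiGraph n) (P : Fin n → Set) : Fin n → Fin n → Set where
  here : ∀ {u} → P u → WalkIn G P u u
  step : ∀ {u w v} → P u → Edge G u w → WalkIn G P w v → WalkIn G P u v

Walk : ∀ {n} → DiGraph n → Fin n → Fin n → Set
Walk G = WalkIn G (λ _ → Data.Unit.⊤)
  where import Data.Unit

record IsSTGraph {n} (G : DiGraph n) (s t : Fin n) : Set where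
  field
    noLoops  : ∀ v → ¬ Edge G v v
    s≢t      : s ≢ t
    onWalk   : ∀ v → Walk G s v × Walk G v t

-- A cut (S , T) is represented by the indicator S : Fin n → Bool,
-- S v ≡ true meaning v ∈ S, S v ≡ false meaning v ∈ T.
IsCut : ∀ {n} → Fin n → Fin n → (Fin n → Bool) → Set
IsCut s t S = (S s ≡ true) × (S t ≡ false)

InS InT : ∀ {n} → (Fin n → Bool) → Fin n → Set
InS S v = S v ≡ true
InT S v = S v ≡ false

InCutSet : ∀ {n} → DiGraph n → (Fin n → Bool) → Fin n → Fin n → Set
InCutSet G S u v = Edge G u v × InS S u × InT S v

IsConnectedCut : ∀ {n} → DiGraph n → Fin n → Fin n → (Fin n → Bool) → Set
IsConnectedCut G s t S =
  IsCut s t S ×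
  (∀ v → InS S v → WalkIn G (InS S) s v) ×
  (∀ v → InT S v → WalkIn G (InT S) v t)

ProperSubCutSet : ∀ {n} → DiGraph n → (Fin n → Bool) → (Fin n → Bool) → Set
ProperSubCutSet G S' S =
  (∀ u v → InCutSet G S' u v → InCutSet G S u v) ×
  ∃₂ (λ u v → InCutSet G S u v × ¬ InCutSet G S' u v)

module Submission where

-- Let (S , T) be connected and suppose cut(S') ⊆ cut(S).  The key fact is
-- that a walk which starts in S' and ends in T' must use an edge of cut(S');
-- if the walk stays inside one side of (S , T), that edge has both ends on
-- the same side, so it cannot belong to cut(S) — contradicting the inclusion.
-- Applying this to the walk s ⇝ u inside S (for u ∈ S) shows S ⊆ S', and to
-- the walk v ⇝ t inside T (for v ∈ T) shows T ⊆ T'.  Hence every edge of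
-- cut(S) lies in cut(S'), so the inclusion cannot be proper.

open import Defs
open import Data.Nat using (ℕ)
open import Data.Fin using (Fin)
open import Data.Bool using (Bool; true; false)
open import Data.Product using (_×_; _,_; Σ-syntax)
open import Relation.Nullary using (¬_)
open import Relation.Binary.PropositionalEquality using (_≡_; refl; sym; trans)

private
  variable
    n : ℕ

walkStart : {G : DiGraph n} {P : Fin n → Set} {a b : Fin n} →
            WalkIn G P a b → P a
walkStart (here p)     = p
walkStart (step p _ _) = p

crossingEdge : {G : DiGraph n} {P : Fin n → Set} (S' : Fin n → Bool) {a b : Fin n} →
               WalkIn G P a b → InS S' a → InT S' b →
               Σ[ x ∈ Fin n ] Σ[ y ∈ Fin n ] P x × P y × InCutSet G S' x y
crossingEdge S' (here _) a∈S' a∈T' with () ← trans (sym a∈S') a∈T'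
crossingEdge S' (step {w = w} p e rest) a∈S' b∈T' with S' w in w∈S'
... | false = _ , w , p , walkStart rest , e , a∈S' , w∈S'
... | true  = crossingEdge S' rest w∈S' b∈T'

CutSetIncluded : DiGraph n → (Fin n → Bool) → (Fin n → Bool) → Set
CutSetIncluded G S' S = ∀ u v → InCutSet G S' u v → InCutSet G S u v

noCutEdgeInsideS : {G : DiGraph n} {S S' : Fin n → Bool} →
                   CutSetIncluded G S' S → {x y : Fin n} →
                   InS S x → InS S y → ¬ InCutSet G S' x y
noCutEdgeInsideS incl {x} {y} _ y∈S c
  with _ , _ , y∈T ← incl x y c
  with () ← trans (sym y∈S) y∈T

noCutEdgeInsideT : {G : DiGraph n} {S S' : Fin n → Bool} →
                   CutSetIncluded G S' S → {x y : Fin n} →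
                   InT S x → InT S y → ¬ InCutSet G S' x y
noCutEdgeInsideT incl {x} {y} x∈T _ c
  with _ , x∈S , _ ← incl x y c
  with () ← trans (sym x∈S) x∈T

sourceSideIncluded : {G : DiGraph n} {s : Fin n} {S S' : Fin n → Bool} →
                     (∀ v → InS S v → WalkIn G (InS S) s v) → InS S' s →
                     CutSetIncluded G S' S →
                     ∀ u → InS S u → InS S' u
sourceSideIncluded {S' = S'} reach s∈S' incl u u∈S with S' u in u∈S'
... | true  = refl
... | false with x , y , x∈S , y∈S , c ← crossingEdge S' (reach u u∈S) s∈S' u∈S'
  with () ← noCutEdgeInsideS incl x∈S y∈S c

sinkSideIncluded : {G : DiGraph n} {t : Fin n} {S S' : Fin n → Bool} →
                   (∀ v → InT S v → WalkIn G (InT S) v t) → InT S' t →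
                   CutSetIncluded G S' S →
                   ∀ v → InT S v → InT S' v
sinkSideIncluded {S' = S'} reach t∈T' incl v v∈T with S' v in v∈S'
... | false = refl
... | true with x , y , x∈T , y∈T , c ← crossingEdge S' (reach v v∈T) v∈S' t∈T'
  with () ← noCutEdgeInsideT incl x∈T y∈T c

lemma2 : ∀ {n} (G : DiGraph n) (s t : Fin n) → IsSTGraph G s t →
         (S : Fin n → Bool) → IsConnectedCut G s t S →
         (S' : Fin n → Bool) → IsCut s t S' →
         ¬ ProperSubCutSet G S' S
lemma2 G s t _ S (_ , reachS , reachT) S' (s∈S' , t∈T') (incl , u , v , (e , u∈S , v∈T) , notInS')
  = notInS' (e , u∈S' , v∈T')
  where
    u∈S' : InS S' u
    u∈S' = sourceSideIncluded reachS s∈S' incl u u∈S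

    v∈T' : InT S' v
    v∈T' = sinkSideIncluded reachT t∈T' incl v v∈T
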